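{- Let $G$ be a graph such that every connected component of $G$ has at least three vertices, and let $X\subseteq V(G)$. Then there exists a minimum $\Delta$-completion set $F$ of $X$ such that for every edge $uv\in F$ we have $N_G(u)\cap N_G(v)\neq\emptyset$, that is, $\mathsf{dist}_G(u,v)=2$.
   Context: All graphs are finite and simple. For $X\subseteq V(G)$, a $\Delta$-completion set of $X$ is a set $F$ of non-edges of $G$ such that every vertex of $X$ lies in a triangle of $G+F$; it is minimum if it has the smallest possible size among such sets. $N_G(v)$ is the set of neighbours of $v$ in $G$ and $\mathsf{dist}_G(u,v)$ is the distance in $G$. -}

module Defs where

open import Data.Nat using (ℕ; _≤_; _<_)
open import Data.Fin using (Fin; toℕ)
open import Data.Fin.Subset using (Subset; _∈_)
open import Data.Bool using (Bool; true; false)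
open import Data.Product using (_×_; _,_; Σ; ∃; ∃-syntax)
open import Data.Sum using (_⊎_)
open import Data.List using (List; length)
open import Data.List.Relation.Unary.Unique.Propositional using (Unique)
import Data.List.Membership.Propositional as LM
open import Relation.Binary.PropositionalEquality using (_≡_)
open import Relation.Nullary using (¬_)

record Graph (n : ℕ) : Set where
  field
    adj   : Fin n → Fin n → Bool
    sym   : ∀ u v → adj u v ≡ adj v u
    irrefl : ∀ v → adj v v ≡ false

open Graph public

Adj : ∀ {n} → Graph n → Fin n → Fin n → Set
Adj G u v = adj G u v ≡ true

data Reach {n} (G : Graph n) : Fin n → Fin n → Set where
  here : ∀ {v} → Reach G v v
  step : ∀ {u w v} → Adj G u w → Reach G w v → Reach G u v

-- Every connected component has at least three vertices:
-- each vertex v reaches three pairwise distinct vertices (v among them or not).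
ComponentsAtLeast3 : ∀ {n} → Graph n → Set
ComponentsAtLeast3 {n} G =
  ∀ (v : Fin n) → ∃[ a ] ∃[ b ] ∃[ c ]
    (¬ a ≡ b × ¬ a ≡ c × ¬ b ≡ c ×
     Reach G v a × Reach G v b × Reach G v c)

-- A set of non-edges of G, encoded as a duplicate-free list of ordered
-- pairs (u , v) with toℕ u < toℕ v (so each unordered pair appears once)
-- such that uv is not an edge of G.
NonEdgeSet : ∀ {n} → Graph n → List (Fin n × Fin n) → Set
NonEdgeSet G F =
  Unique F × (∀ {u v} → (u , v) LM.∈ F → toℕ u < toℕ v × ¬ Adj G u v)

AdjPlus : ∀ {n} → Graph n → List (Fin n × Fin n) → Fin n → Fin n → Set
AdjPlus G F u v = Adj G u v ⊎ (u , v) LM.∈ F ⊎ (v , u) LM.∈ F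

InTriangle : ∀ {n} → Graph n → List (Fin n × Fin n) → Fin n → Set
InTriangle G F x = ∃[ a ] ∃[ b ]
  (¬ x ≡ a × ¬ x ≡ b × ¬ a ≡ b ×
   AdjPlus G F x a × AdjPlus G F x b × AdjPlus G F a b)

IsCompletion : ∀ {n} → Graph n → Subset n → List (Fin n × Fin n) → Set
IsCompletion {n} G X F =
  NonEdgeSet G F × (∀ (x : Fin n) → x ∈ X → InTriangle G F x)

IsMinCompletion : ∀ {n} → Graph n → Subset n → List (Fin n × Fin n) → Set
IsMinCompletion G X F =
  IsCompletion G X F ×
  (∀ F′ → IsCompletion G X F′ → length F ≤ length F′)

CommonNeighbour : ∀ {n} → Graph n → Fin n → Fin n → Set
CommonNeighbour G u v = ∃[ w ] (Adj G u w × Adj G v w)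

{-# OPTIONS --safe #-}
-- Split any Δ-completion set F into its good edges (endpoints with a common neighbour) and its
-- bad edges B, and let N be the vertices of X lying in no triangle of G + good edges. Each vertex
-- of N sits in a triangle of G + F of one of three shapes using B. Hence, in every component C of
-- the graph B, the vertices of N can be covered by |B ∩ C| edges of G: one per vertex if C has a
-- cycle, and otherwise one fewer, because the leaf last added to a spanning tree either is not in
-- N, or has its B-neighbour outside N, or has a G-edge to another vertex of C covering both. Each
-- such G-edge uv needs at most one good edge to put both u and v in triangles, since the component
-- of uv in G has a third vertex. So there is a good completion set no larger than F, and a
-- shortest one among the finitely many good completion sets is a minimum completion set.
module Submission where

open import Defs
open import Data.Bool using (true; false)
import Data.Bool.Properties as Bool
open import Data.Empty using (⊥; ⊥-elim)
open import Data.Fin using (Fin; toℕ; _≟_)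
open import Data.Fin.Properties using (any?; all?; toℕ-injective)
open import Data.Fin.Subset using (Subset) renaming (_∈_ to _∈ₛ_)
open import Data.Fin.Subset.Properties using () renaming (_∈?_ to _∈ₛ?_)
open import Data.List using (List; []; _∷_; [_]; length; filter; map; _++_; allFin; cartesianProduct)
open import Data.List.Extrema.Nat using (argmin; argmin-all; f[argmin]≤f[xs])
open import Data.List.Membership.Propositional using (_∈_; _∉_; find; lose)
open import Data.List.Membership.Propositional.Properties
  using (∈-filter⁺; ∈-filter⁻; ∈-map⁺; ∈-++⁺ˡ; ∈-++⁺ʳ; ∈-allFin; ∈-cartesianProduct⁺)
import Data.List.Membership.DecPropositional as DecMembership
open import Data.List.Properties using (filter-notAll; length-++; length-map; length-tabulate)
open import Data.List.Relation.Binary.Subset.Propositional using (_⊆_)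
open import Data.List.Relation.Unary.All as All using (All; []; _∷_)
import Data.List.Relation.Unary.All.Properties as AllP
open import Data.List.Relation.Unary.Any as Any using (Any; here; there)
import Data.List.Relation.Unary.Any.Properties as AnyP
open import Data.List.Relation.Unary.Unique.Propositional using (Unique; []; _∷_)
open import Data.List.Relation.Unary.Unique.Propositional.Properties
  using (allFin⁺; cartesianProduct⁺; filter⁺)
open import Data.List.Relation.Unary.Unique.DecPropositional using (unique?)
open import Data.Nat using (ℕ; zero; suc; _+_; _≤_; _<_; z≤n; s≤s; _<?_)
open import Data.Nat.Properties
  using ( ≤-refl; ≤-reflexive; ≤-trans; <-irrefl; <-cmp; <⇒≱; ≤-pred; n<1+n
        ; +-identityʳ; +-suc; +-mono-≤; +-monoˡ-≤; +-monoʳ-≤; module ≤-Reasoning)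
open import Data.Product using (_×_; _,_; ∃; ∃₂; ∃-syntax; proj₁; proj₂; uncurry)
open import Data.Product.Properties using (≡-dec)
open import Data.Sum using (_⊎_; inj₁; inj₂)
open import Function using (_∘_; id; case_of_)
open import Level using (0ℓ)
open import Relation.Binary.Definitions using (DecidableEquality; tri<; tri≈; tri>)
open import Relation.Binary.PropositionalEquality as ≡ using (_≡_; _≢_; refl; cong)
open import Relation.Nullary using (¬_; Dec; yes; no; ¬?; does)
open import Relation.Nullary.Decidable using (_×-dec_; _⊎-dec_; _→-dec_; decidable-stable)
open import Relation.Unary using (Pred; Decidable; ∁; _∩_; _∪_)
open import Relation.Unary.Properties using (∁?; _∩?_)

module _ {A : Set} where

  length-filter+filter-∁ : ∀ {P : Pred A 0ℓ} (P? : Decidable P) xs →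
    length (filter P? xs) + length (filter (∁? P?) xs) ≡ length xs
  length-filter+filter-∁ P? [] = refl
  length-filter+filter-∁ P? (x ∷ xs) with P? x
  ... | yes _ = cong suc (length-filter+filter-∁ P? xs)
  ... | no  _ = ≡.trans (+-suc _ _) (cong suc (length-filter+filter-∁ P? xs))

  sublists : List A → List (List A)
  sublists []       = [ [] ]
  sublists (x ∷ xs) = map (x ∷_) (sublists xs) ++ sublists xs

  filter∈sublists : ∀ {P : Pred A 0ℓ} (P? : Decidable P) xs → filter P? xs ∈ sublists xs
  filter∈sublists P? []       = here refl
  filter∈sublists P? (x ∷ xs) with does (P? x)
  ... | true  = ∈-++⁺ˡ (∈-map⁺ (x ∷_) (filter∈sublists P? xs))
  ... | false = ∈-++⁺ʳ (map (x ∷_) (sublists xs)) (filter∈sublists P? xs)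

  shortest : ∀ {xs : List A} {xss} → xs ∈ xss →
    ∃[ m ] (m ∈ xss × (∀ {ys} → ys ∈ xss → length m ≤ length ys))
  shortest {xs} {xss} xs∈xss =
    argmin length xs xss , argmin-all length xs∈xss (All.tabulate (λ ys∈xss → ys∈xss)) ,
    All.lookup (f[argmin]≤f[xs] xs xss)

  pigeonhole₂ : ∀ {v w a b c : A} → a ≡ v ⊎ a ≡ w → b ≡ v ⊎ b ≡ w → c ≡ v ⊎ c ≡ w →
    a ≢ b → a ≢ c → b ≢ c → ⊥
  pigeonhole₂ (inj₁ refl) (inj₁ refl) _           a≢b _   _   = a≢b refl
  pigeonhole₂ (inj₂ refl) (inj₂ refl) _           a≢b _   _   = a≢b refl
  pigeonhole₂ (inj₁ refl) (inj₂ refl) (inj₁ refl) _   a≢c _   = a≢c refl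
  pigeonhole₂ (inj₁ refl) (inj₂ refl) (inj₂ refl) _   _   b≢c = b≢c refl
  pigeonhole₂ (inj₂ refl) (inj₁ refl) (inj₁ refl) _   _   b≢c = b≢c refl
  pigeonhole₂ (inj₂ refl) (inj₁ refl) (inj₂ refl) _   a≢c _   = a≢c refl

  other-end : ∀ {a c x : A} {e} → c ≢ a → e ≡ (a , c) ⊎ e ≡ (c , a) →
    (c , x) ≡ e ⊎ (x , c) ≡ e → x ≡ a
  other-end c≢a (inj₁ refl) (inj₁ refl) = ⊥-elim (c≢a refl)
  other-end c≢a (inj₁ refl) (inj₂ refl) = refl
  other-end c≢a (inj₂ refl) (inj₁ refl) = refl
  other-end c≢a (inj₂ refl) (inj₂ refl) = ⊥-elim (c≢a refl)

module _ {A : Set} (_≟ᴬ_ : DecidableEquality A) where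

  Unique-⊆⇒length≤ : ∀ {xs ys : List A} → Unique xs → xs ⊆ ys → length xs ≤ length ys
  Unique-⊆⇒length≤ {[]}     _             _       = z≤n
  Unique-⊆⇒length≤ {x ∷ xs} {ys} (x∉xs ∷ !xs) x∷xs⊆ys =
    ≤-trans (s≤s (Unique-⊆⇒length≤ !xs xs⊆ys-x))
            (filter-notAll (¬? ∘ (x ≟ᴬ_)) ys (Any.map (λ x≡y x≢y → x≢y x≡y) (x∷xs⊆ys (here refl))))
    where
    xs⊆ys-x : xs ⊆ filter (¬? ∘ (x ≟ᴬ_)) ys
    xs⊆ys-x z∈xs = ∈-filter⁺ (¬? ∘ (x ≟ᴬ_)) (x∷xs⊆ys (there z∈xs)) (All.lookup x∉xs z∈xs)

∈⇒0<length : ∀ {A : Set} {x : A} {xs} → x ∈ xs → 0 < length xs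
∈⇒0<length {xs = _ ∷ _} _ = s≤s z≤n

Unique⇒length≤ : ∀ {n} {C : List (Fin n)} → Unique C → length C ≤ n
Unique⇒length≤ {n} !C =
  ≤-trans (Unique-⊆⇒length≤ _≟_ !C (λ {x} _ → ∈-allFin x)) (≤-reflexive (length-tabulate (λ x → x)))

Edge : ℕ → Set
Edge n = Fin n × Fin n

module _ {n : ℕ} where

  _≟ₑ_ : DecidableEquality (Edge n)
  _≟ₑ_ = ≡-dec _≟_ _≟_

  open DecMembership (_≟_ {n}) using () renaming (_∈?_ to _∈ᵥ?_) public
  open DecMembership _≟ₑ_ using () renaming (_∈?_ to _∈ₑ?_) public

  Joined : List (Edge n) → Fin n → Fin n → Set
  Joined L u v = (u , v) ∈ L ⊎ (v , u) ∈ L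

  joined-sym : ∀ {L u v} → Joined L u v → Joined L v u
  joined-sym (inj₁ uv) = inj₂ uv
  joined-sym (inj₂ vu) = inj₁ vu

  joined-mono : ∀ {L L′ u v} → L ⊆ L′ → Joined L u v → Joined L′ u v
  joined-mono L⊆L′ (inj₁ uv) = inj₁ (L⊆L′ uv)
  joined-mono L⊆L′ (inj₂ vu) = inj₂ (L⊆L′ vu)

  joined? : ∀ L u v → Dec (Joined L u v)
  joined? L u v = ((u , v) ∈ₑ? L) ⊎-dec ((v , u) ∈ₑ? L)

  Loopless : List (Edge n) → Set
  Loopless L = ∀ {u v} → (u , v) ∈ L → u ≢ v

  allPairs : List (Edge n)
  allPairs = cartesianProduct (allFin n) (allFin n)

  Covers : Fin n → Edge n → Set
  Covers y (u , v) = y ≡ u ⊎ y ≡ v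

module _ {n : ℕ} (G : Graph n) where

  adj-sym : ∀ {u v} → Adj G u v → Adj G v u
  adj-sym {u} {v} = ≡.trans (sym G v u)

  adj-irrefl : ∀ {v} → ¬ Adj G v v
  adj-irrefl {v} vv with ≡.trans (≡.sym (irrefl G v)) vv
  ... | ()

  adj⇒≢ : ∀ {u v} → Adj G u v → u ≢ v
  adj⇒≢ uv refl = adj-irrefl uv

  adj? : ∀ u v → Dec (Adj G u v)
  adj? u v = adj G u v Bool.≟ true

  reach-≢⇒neighbour : ∀ {v x} → Reach G v x → x ≢ v → ∃ (Adj G v)
  reach-≢⇒neighbour here              x≢v = ⊥-elim (x≢v refl)
  reach-≢⇒neighbour (step {w = w} vw _) _  = w , vw

  reach-from-isolated-edge : ∀ {v w} → (∀ {z} → Adj G v z → z ≡ w) → (∀ {z} → Adj G w z → z ≡ v) →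
    ∀ {u x} → u ≡ v ⊎ u ≡ w → Reach G u x → x ≡ v ⊎ x ≡ w
  reach-from-isolated-edge only-w only-v u∈vw          here          = u∈vw
  reach-from-isolated-edge only-w only-v (inj₁ refl) (step uz z⇝x) =
    reach-from-isolated-edge only-w only-v (inj₂ (only-w uz)) z⇝x
  reach-from-isolated-edge only-w only-v (inj₂ refl) (step uz z⇝x) =
    reach-from-isolated-edge only-w only-v (inj₁ (only-v uz)) z⇝x

  commonNeighbour? : ∀ u v → Dec (CommonNeighbour G u v)
  commonNeighbour? u v = any? λ w → adj? u w ×-dec adj? v w

  commonNeighbour-sym : ∀ {u v} → CommonNeighbour G u v → CommonNeighbour G v u
  commonNeighbour-sym (w , uw , vw) = w , vw , uw

  Good : Edge n → Set
  Good (u , v) = CommonNeighbour G u v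

  good? : Decidable Good
  good? (u , v) = commonNeighbour? u v

  Normal : Edge n → Set
  Normal (u , v) = toℕ u < toℕ v × ¬ Adj G u v

  normal? : Decidable Normal
  normal? (u , v) = (toℕ u <? toℕ v) ×-dec ¬? (adj? u v)

  Short : Edge n → Set
  Short = Normal ∩ Good

  normal-loopless : ∀ {L} → All Normal L → Loopless L
  normal-loopless normal uv∈L refl = <-irrefl refl (proj₁ (All.lookup normal uv∈L))

  orient : ∀ {u v} → u ≢ v → ¬ Adj G u v → CommonNeighbour G u v →
    ∃[ p ] (Short p × Joined [ p ] u v)
  orient {u} {v} u≢v ¬uv (w , uw , vw) with <-cmp (toℕ u) (toℕ v)
  ... | tri< u<v _ _ = (u , v) , ((u<v , ¬uv) , (w , uw , vw)) , inj₁ (here refl)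
  ... | tri≈ _ u≡v _ = ⊥-elim (u≢v (toℕ-injective u≡v))
  ... | tri> _ _ v<u = (v , u) , ((v<u , ¬uv ∘ adj-sym) , (w , vw , uw)) , inj₂ (here refl)

  adjPlus-sym : ∀ {L u v} → AdjPlus G L u v → AdjPlus G L v u
  adjPlus-sym (inj₁ uv) = inj₁ (adj-sym uv)
  adjPlus-sym (inj₂ uv) = inj₂ (joined-sym uv)

  adjPlus⇒≢ : ∀ {L u v} → Loopless L → AdjPlus G L u v → u ≢ v
  adjPlus⇒≢ loopless (inj₁ uv)        = adj⇒≢ uv
  adjPlus⇒≢ loopless (inj₂ (inj₁ uv)) = loopless uv
  adjPlus⇒≢ loopless (inj₂ (inj₂ vu)) = loopless vu ∘ ≡.sym

  adjPlus-mono : ∀ {L L′ u v} → L ⊆ L′ → AdjPlus G L u v → AdjPlus G L′ u v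
  adjPlus-mono L⊆L′ (inj₁ uv) = inj₁ uv
  adjPlus-mono L⊆L′ (inj₂ uv) = inj₂ (joined-mono L⊆L′ uv)

  adjPlus? : ∀ L u v → Dec (AdjPlus G L u v)
  adjPlus? L u v = adj? u v ⊎-dec joined? L u v

  triangle : ∀ {L x a b} → Loopless L →
    AdjPlus G L x a → AdjPlus G L x b → AdjPlus G L a b → InTriangle G L x
  triangle loopless xa xb ab =
    _ , _ , adjPlus⇒≢ loopless xa , adjPlus⇒≢ loopless xb , adjPlus⇒≢ loopless ab , xa , xb , ab

  inTriangle-mono : ∀ {L L′ x} → L ⊆ L′ → InTriangle G L x → InTriangle G L′ x
  inTriangle-mono L⊆L′ (a , b , x≢a , x≢b , a≢b , xa , xb , ab) =
    a , b , x≢a , x≢b , a≢b , adjPlus-mono L⊆L′ xa , adjPlus-mono L⊆L′ xb , adjPlus-mono L⊆L′ ab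

  inTriangle? : ∀ L x → Dec (InTriangle G L x)
  inTriangle? L x = any? λ a → any? λ b →
    ¬? (x ≟ a) ×-dec ¬? (x ≟ b) ×-dec ¬? (a ≟ b) ×-dec
    adjPlus? L x a ×-dec adjPlus? L x b ×-dec adjPlus? L a b

  sole-neighbour : ∀ {u x} → ¬ (∃ λ z → Adj G u z × z ≢ x) → ∀ {z} → Adj G u z → z ≡ x
  sole-neighbour {x = x} none {z} uz = decidable-stable (z ≟ x) (λ z≢x → none (z , uz , z≢x))

  record Cover (k : ℕ) (U : Pred (Fin n) 0ℓ) : Set where
    field
      edges    : List (Edge n)
      small    : length edges ≤ k
      adjacent : All (uncurry (Adj G)) edges
      covers   : ∀ {y} → U y → Any (Covers y) edges

  cover-∅ : Cover 0 (λ _ → ⊥)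
  cover-∅ = record { edges = [] ; small = z≤n ; adjacent = [] ; covers = λ () }

  cover-edge : ∀ {u v} → Adj G u v → Cover 1 (λ y → Covers y (u , v))
  cover-edge {u} {v} uv =
    record { edges = [ u , v ] ; small = s≤s z≤n ; adjacent = uv ∷ [] ; covers = here }

  cover-mono : ∀ {k l U W} → k ≤ l → (∀ {y} → U y → W y) → Cover k W → Cover l U
  cover-mono k≤l U⊆W c = record
    { edges = edges ; small = ≤-trans small k≤l ; adjacent = adjacent ; covers = covers ∘ U⊆W }
    where open Cover c

  cover-++ : ∀ {k l U W} → Cover k U → Cover l W → Cover (k + l) (U ∪ W)
  cover-++ c d = record
    { edges    = C.edges ++ D.edges
    ; small    = ≤-trans (≤-reflexive (length-++ C.edges)) (+-mono-≤ C.small D.small)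
    ; adjacent = AllP.++⁺ C.adjacent D.adjacent
    ; covers   = λ { (inj₁ Uy) → AnyP.++⁺ˡ (C.covers Uy) ; (inj₂ Wy) → AnyP.++⁺ʳ C.edges (D.covers Wy) }
    }
    where
    module C = Cover c
    module D = Cover d

  -- The triangles of G + H through y when H holds the bad edges of a completion set and N the
  -- vertices not yet in a triangle through good edges; `leave` arises when the side ab is good.
  data Supported (H : List (Edge n)) (N : Pred (Fin n) 0ℓ) (y : Fin n) : Set where
    fork  : ∀ {a b} → a ≢ b → Joined H y a → Joined H y b → Supported H N y
    hook  : ∀ {a b} → Joined H y a → Adj G y b → Joined H a b → Supported H N y
    leave : ∀ {a} → Joined H y a → ¬ N a → Supported H N y

  supported⇒joined : ∀ {H N y} → Supported H N y → ∃ (Joined H y)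
  supported⇒joined (fork _ ya _)  = _ , ya
  supported⇒joined (hook ya _ _)  = _ , ya
  supported⇒joined (leave ya _)   = _ , ya

module Spanning {n : ℕ} (H : List (Edge n)) where

  data Tree (r : Fin n) : List (Fin n) → List (Edge n) → Set where
    root   : Tree r [ r ] []
    branch : ∀ {C T a c e} → Tree r C T → e ∈ H → a ∈ C → c ∉ C →
             e ≡ (a , c) ⊎ e ≡ (c , a) → Tree r (c ∷ C) (e ∷ T)

  Closed : List (Fin n) → Set
  Closed C = ∀ {u v} → Joined H u v → u ∈ C → v ∈ C

  -- For a closed C these are exactly the edges of H with both endpoints in C.
  inside : List (Fin n) → List (Edge n)
  inside C = filter (λ e → proj₁ e ∈ᵥ? C) H

  outside : List (Fin n) → List (Edge n)
  outside C = filter (∁? (λ e → proj₁ e ∈ᵥ? C)) H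

  module _ {r : Fin n} where

    tree-root : ∀ {C T} → Tree r C T → r ∈ C
    tree-root root                 = here refl
    tree-root (branch t _ _ _ _)   = there (tree-root t)

    tree-size : ∀ {C T} → Tree r C T → length C ≡ suc (length T)
    tree-size root                 = refl
    tree-size (branch t _ _ _ _)   = cong suc (tree-size t)

    tree-vertices-unique : ∀ {C T} → Tree r C T → Unique C
    tree-vertices-unique root                  = [] ∷ []
    tree-vertices-unique (branch t _ _ c∉C _)  = AllP.¬Any⇒All¬ _ c∉C ∷ tree-vertices-unique t

    tree-endpoints : ∀ {C T u v} → Tree r C T → (u , v) ∈ T → u ∈ C × v ∈ C
    tree-endpoints (branch _ _ a∈C _ (inj₁ refl)) (here refl) = there a∈C , here refl
    tree-endpoints (branch _ _ a∈C _ (inj₂ refl)) (here refl) = here refl , there a∈C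
    tree-endpoints (branch t _ _ _ _)             (there uv∈T) with tree-endpoints t uv∈T
    ... | u∈C , v∈C = there u∈C , there v∈C

    tree-new-edge : ∀ {C T a c e} → Tree r C T → c ∉ C → e ≡ (a , c) ⊎ e ≡ (c , a) → e ∉ T
    tree-new-edge t c∉C (inj₁ refl) e∈T = c∉C (proj₂ (tree-endpoints t e∈T))
    tree-new-edge t c∉C (inj₂ refl) e∈T = c∉C (proj₁ (tree-endpoints t e∈T))

    tree-edges-unique : ∀ {C T} → Tree r C T → Unique T
    tree-edges-unique root                   = []
    tree-edges-unique (branch t _ _ c∉C e≡)  =
      AllP.¬Any⇒All¬ _ (tree-new-edge t c∉C e≡) ∷ tree-edges-unique t

    tree-⊆ : ∀ {C T} → Tree r C T → T ⊆ H
    tree-⊆ (branch _ e∈H _ _ _) (here refl) = e∈H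
    tree-⊆ (branch t _ _ _ _)   (there e∈T) = tree-⊆ t e∈T

    tree-⊆-inside : ∀ {C T} → Tree r C T → T ⊆ inside C
    tree-⊆-inside t {u , v} uv∈T = ∈-filter⁺ _ (tree-⊆ t uv∈T) (proj₁ (tree-endpoints t uv∈T))

  Crossing : List (Fin n) → Edge n → Set
  Crossing C (u , v) = u ∈ C × v ∉ C ⊎ v ∈ C × u ∉ C

  crossing? : ∀ C → Decidable (Crossing C)
  crossing? C (u , v) = (u ∈ᵥ? C ×-dec ¬? (v ∈ᵥ? C)) ⊎-dec (v ∈ᵥ? C ×-dec ¬? (u ∈ᵥ? C))

  no-crossing⇒closed : ∀ {C} → ¬ Any (Crossing C) H → Closed C
  no-crossing⇒closed {C} none {u} {v} uv u∈C = decidable-stable (v ∈ᵥ? C) (none ∘ crossing uv)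
    where
    crossing : Joined H u v → v ∉ C → Any (Crossing C) H
    crossing (inj₁ uv∈H) v∉C = lose uv∈H (inj₁ (u∈C , v∉C))
    crossing (inj₂ vu∈H) v∉C = lose vu∈H (inj₂ (u∈C , v∉C))

  extend : ∀ {k r C T} → Tree r C T → n < length C + k → ∃₂ λ C′ T′ → Tree r C′ T′ × Closed C′
  extend {zero} {C = C} t n<|C| =
    ⊥-elim (<⇒≱ n<|C| (≤-trans (≤-reflexive (+-identityʳ (length C)))
                               (Unique⇒length≤ (tree-vertices-unique t))))
  extend {suc k} {C = C} {T} t n<|C|+1+k with Any.any? (crossing? C) H
  ... | no none = C , T , t , no-crossing⇒closed none
  ... | yes some with find some
  ...   | _ , uv∈H , inj₁ (u∈C , v∉C) =
    extend (branch t uv∈H u∈C v∉C (inj₁ refl)) (≡.subst (n <_) (+-suc (length C) k) n<|C|+1+k)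
  ...   | _ , vu∈H , inj₂ (v∈C , u∉C) =
    extend (branch t vu∈H v∈C u∉C (inj₂ refl)) (≡.subst (n <_) (+-suc (length C) k) n<|C|+1+k)

  component : ∀ r → ∃₂ λ C T → Tree r C T × Closed C
  component r = extend {k = n} root ≤-refl

  leaf : ∀ {r c C e T} → Tree r (c ∷ C) (e ∷ T) → Closed (c ∷ C) → inside (c ∷ C) ⊆ e ∷ T →
    ∃[ a ] (a ∈ C × (∀ {x} → Joined H c x → x ≡ a))
  leaf {c = c} {C} (branch {a = a} t _ a∈C c∉C e≡) closed inside⊆T = a , a∈C , only-a
    where
    c≢a : c ≢ a
    c≢a refl = c∉C a∈C
    only-a : ∀ {x} → Joined H c x → x ≡ a
    only-a (inj₁ cx∈H) with inside⊆T (∈-filter⁺ _ cx∈H (here refl))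
    ... | here cx≡e   = other-end c≢a e≡ (inj₁ cx≡e)
    ... | there cx∈T  = ⊥-elim (c∉C (proj₁ (tree-endpoints t cx∈T)))
    only-a (inj₂ xc∈H) with inside⊆T (∈-filter⁺ _ xc∈H (closed (inj₂ xc∈H) (here refl)))
    ... | here xc≡e   = other-end c≢a e≡ (inj₂ xc≡e)
    ... | there xc∈T  = ⊥-elim (c∉C (proj₂ (tree-endpoints t xc∈T)))

  joined-inside : ∀ {C y a} → Closed C → y ∈ C → Joined H y a → ∃ (_∈ inside C)
  joined-inside closed y∈C (inj₁ ya∈H) = _ , ∈-filter⁺ _ ya∈H y∈C
  joined-inside closed y∈C (inj₂ ay∈H) = _ , ∈-filter⁺ _ ay∈H (closed (inj₂ ay∈H) y∈C)

  joined-outside : ∀ {C y a} → Closed C → y ∉ C → Joined H y a → Joined (outside C) y a × a ∉ C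
  joined-outside closed y∉C (inj₁ ya∈H) =
    inj₁ (∈-filter⁺ _ ya∈H y∉C) , y∉C ∘ closed (inj₂ ya∈H)
  joined-outside closed y∉C (inj₂ ay∈H) =
    inj₂ (∈-filter⁺ _ ay∈H (y∉C ∘ closed (inj₁ ay∈H))) , y∉C ∘ closed (inj₁ ay∈H)

  supported-outside : ∀ {G : Graph n} {N C y} → Closed C → y ∉ C →
    Supported G H N y → Supported G (outside C) (N ∩ ∁ (_∈ C)) y
  supported-outside closed y∉C (fork a≢b ya yb) =
    fork a≢b (proj₁ (joined-outside closed y∉C ya)) (proj₁ (joined-outside closed y∉C yb))
  supported-outside closed y∉C (hook ya yb ab) with joined-outside closed y∉C ya
  ... | ya′ , a∉C = hook ya′ yb (proj₁ (joined-outside closed a∉C ab))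
  supported-outside closed y∉C (leave ya ¬Na) =
    leave (proj₁ (joined-outside closed y∉C ya)) (¬Na ∘ proj₁)

module Forest {n : ℕ} {G : Graph n} (neighbour : ∀ v → ∃ (Adj G v)) where
  open Spanning

  single : Fin n → Edge n
  single v = v , proj₁ (neighbour v)

  cover-by-singles : ∀ C → Cover G (length C) (_∈ C)
  cover-by-singles C = record
    { edges    = map single C
    ; small    = ≤-reflexive (length-map single C)
    ; adjacent = AllP.map⁺ (All.universal (proj₂ ∘ neighbour) C)
    ; covers   = λ y∈C → AnyP.map⁺ (Any.map inj₁ y∈C)
    }

  cover-except : ∀ {C x k} → x ∈ C → length C ≤ suc k → Cover G k (λ y → y ∈ C × y ≢ x)
  cover-except {C} {x} x∈C |C|≤1+k =
    cover-mono G shorter kept (cover-by-singles (filter (¬? ∘ (_≟ x)) C))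
    where
    shorter : length (filter (¬? ∘ (_≟ x)) C) ≤ _
    shorter = ≤-pred (≤-trans
      (filter-notAll (¬? ∘ (_≟ x)) C (Any.map (λ { refl y≢y → y≢y refl }) x∈C)) |C|≤1+k)
    kept : ∀ {y} → y ∈ C × y ≢ x → y ∈ filter (¬? ∘ (_≟ x)) C
    kept (y∈C , y≢x) = ∈-filter⁺ (¬? ∘ (_≟ x)) y∈C y≢x

  cover-except-∁ : ∀ {N : Pred (Fin n) 0ℓ} {C x k} → x ∈ C → ¬ N x → length C ≤ suc k →
    Cover G k (N ∩ (_∈ C))
  cover-except-∁ x∈C ¬Nx |C|≤1+k =
    cover-mono G ≤-refl (λ { (Ny , y∈C) → y∈C , λ { refl → ¬Nx Ny } }) (cover-except x∈C |C|≤1+k)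

  cover-hook : ∀ {c b C k} → Adj G c b → b ∈ C → length C ≤ k → Cover G k (_∈ c ∷ C)
  cover-hook {C = []}    _ () _
  cover-hook {C = _ ∷ _} {k = zero} _ _ ()
  cover-hook {c} {b} {C} {suc k} cb b∈C |C|≤1+k =
    cover-mono G ≤-refl split (cover-++ G (cover-edge G cb) (cover-except b∈C |C|≤1+k))
    where
    split : ∀ {y} → y ∈ c ∷ C → Covers y (c , b) ⊎ (y ∈ C × y ≢ b)
    split (here y≡c) = inj₁ (inj₁ y≡c)
    split {y} (there y∈C) with y ≟ b
    ... | yes y≡b = inj₁ (inj₂ y≡b)
    ... | no  y≢b = inj₂ (y∈C , y≢b)

  module _ {H : List (Edge n)} {N : Pred (Fin n) 0ℓ} (N? : Decidable N)
           (supported : ∀ {y} → N y → Supported G H N y) where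

    leaf-cover : ∀ {c C a k} → Closed H (c ∷ C) → a ∈ C → (∀ {x} → Joined H c x → x ≡ a) →
      length (c ∷ C) ≤ suc k → Cover G k (N ∩ (_∈ c ∷ C))
    leaf-cover {c} {C} {a} {k} closed a∈C only-a size with N? c
    ... | no  ¬Nc = cover-except-∁ (here refl) ¬Nc size
    ... | yes Nc  = from-support (supported Nc)
      where
      from-support : Supported G H N c → Cover G k (N ∩ (_∈ c ∷ C))
      from-support (fork a₁≢a₂ ca₁ ca₂) = ⊥-elim (a₁≢a₂ (≡.trans (only-a ca₁) (≡.sym (only-a ca₂))))
      from-support (leave ca′ ¬Na′) =
        cover-except-∁ (there a∈C) (≡.subst (¬_ ∘ N) (only-a ca′) ¬Na′) size
      from-support (hook {a′} {b} ca′ cb a′b) =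
        cover-mono G ≤-refl proj₂ (cover-hook cb b∈C (≤-pred size))
        where
        b∈C : b ∈ C
        b∈C with closed a′b (≡.subst (_∈ c ∷ C) (≡.sym (only-a ca′)) (there a∈C))
        ... | here b≡c  = ⊥-elim (adj⇒≢ G cb (≡.sym b≡c))
        ... | there b∈C = b∈C

    tree-cover : ∀ {r C T e} → Tree H r C T → Closed H C → inside H C ⊆ T → e ∈ inside H C →
      Cover G (length T) (N ∩ (_∈ C))
    tree-cover root _ inside⊆[] e∈ = case inside⊆[] e∈ of λ ()
    tree-cover t@(branch _ _ _ _ _) closed inside⊆T _ with leaf H t closed inside⊆T
    ... | a , a∈C , only-a = leaf-cover closed a∈C only-a (≤-reflexive (tree-size H t))

    component-cover : ∀ {r C T e} → Tree H r C T → Closed H C → e ∈ inside H C →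
      Cover G (length (inside H C)) (N ∩ (_∈ C))
    component-cover {C = C} {T} t closed e∈ with Any.any? (λ e → ¬? (e ∈ₑ? T)) (inside H C)
    ... | yes cycle with find cycle
    ...   | e′ , e′∈ , e′∉T = cover-mono G |C|≤ proj₂ (cover-by-singles C)
      where
      |C|≤ : length C ≤ length (inside H C)
      |C|≤ = ≤-trans (≤-reflexive (tree-size H t))
        (Unique-⊆⇒length≤ _≟ₑ_ (AllP.¬Any⇒All¬ T e′∉T ∷ tree-edges-unique H t)
          λ { (here refl) → e′∈ ; (there e∈T) → tree-⊆-inside H t e∈T })
    component-cover {C = C} {T} t closed e∈ | no acyclic =
      cover-mono G (Unique-⊆⇒length≤ _≟ₑ_ (tree-edges-unique H t) (tree-⊆-inside H t)) id
        (tree-cover t closed inside⊆T e∈)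
      where
      inside⊆T : inside H C ⊆ T
      inside⊆T {e} e∈ = decidable-stable (e ∈ₑ? T) (acyclic ∘ lose e∈)

  supported-cover : ∀ H {N : Pred (Fin n) 0ℓ} → Decidable N → (∀ {y} → N y → Supported G H N y) →
    Cover G (length H) N
  supported-cover H = go H (n<1+n (length H))
    where
    go : ∀ {k} H {N : Pred (Fin n) 0ℓ} → length H < k → Decidable N →
      (∀ {y} → N y → Supported G H N y) → Cover G (length H) N
    go {suc k} H {N} (s≤s |H|≤k) N? supported with any? N?
    ... | no ∄N = cover-mono G z≤n (λ Ny → ⊥-elim (∄N (_ , Ny))) (cover-∅ G)
    ... | yes (y₀ , Ny₀) = peel (component H y₀)
      where
      peel : (∃₂ λ C T → Tree H y₀ C T × Closed H C) → Cover G (length H) N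
      peel (C , T , t , closed) =
        cover-mono G (≤-reflexive (length-filter+filter-∁ _ H)) split (cover-++ G inner outer)
        where
        e₀∈ : ∃ (_∈ inside H C)
        e₀∈ = joined-inside H closed (tree-root H t) (proj₂ (supported⇒joined G (supported Ny₀)))
        inner : Cover G (length (inside H C)) (N ∩ (_∈ C))
        inner = component-cover N? supported t closed (proj₂ e₀∈)
        smaller : length (outside H C) < k
        smaller = ≤-trans (+-monoˡ-≤ (length (outside H C)) (∈⇒0<length (proj₂ e₀∈)))
                    (≤-trans (≤-reflexive (length-filter+filter-∁ _ H)) |H|≤k)
        outer : Cover G (length (outside H C)) (N ∩ ∁ (_∈ C))
        outer = go (outside H C) smaller (N? ∩? ∁? (_∈ᵥ? C))
                  (λ (Ny , y∉C) → supported-outside H closed y∉C (supported Ny))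
        split : ∀ {y} → N y → (N ∩ (_∈ C)) y ⊎ (N ∩ ∁ (_∈ C)) y
        split {y} Ny with y ∈ᵥ? C
        ... | yes y∈C = inj₁ (Ny , y∈C)
        ... | no  y∉C = inj₂ (Ny , y∉C)

module _ {n : ℕ} {G : Graph n} (G≥3 : ComponentsAtLeast3 G) where

  neighbour : ∀ v → ∃ (Adj G v)
  neighbour v with G≥3 v
  ... | a , b , _ , a≢b , _ , _ , v⇝a , v⇝b , _ with a ≟ v
  ...   | no  a≢v  = reach-≢⇒neighbour G v⇝a a≢v
  ...   | yes refl = reach-≢⇒neighbour G v⇝b (a≢b ∘ ≡.sym)

  no-isolated-edge : ∀ {v w} → (∀ {z} → Adj G v z → z ≡ w) → (∀ {z} → Adj G w z → z ≡ v) → ⊥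
  no-isolated-edge {v} {w} only-w only-v with G≥3 v
  ... | a , b , c , a≢b , a≢c , b≢c , v⇝a , v⇝b , v⇝c =
    pigeonhole₂ (within v⇝a) (within v⇝b) (within v⇝c) a≢b a≢c b≢c
    where
    within : ∀ {x} → Reach G v x → x ≡ v ⊎ x ≡ w
    within = reach-from-isolated-edge G only-w only-v (inj₁ refl)

  Closable : Fin n → Fin n → Set
  Closable v w = ∃[ L ] (length L ≤ 1 × All (Short G) L × InTriangle G L v × InTriangle G L w)

  closable-sym : ∀ {v w} → Closable v w → Closable w v
  closable-sym (L , size , short , in-v , in-w) = L , size , short , in-w , in-v

  closable-via : ∀ {v w z} → Adj G v w → Adj G v z → z ≢ w → Closable v w
  closable-via {v} {w} {z} vw vz z≢w with adj? G w z
  ... | yes wz = [] , z≤n , [] ,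
    triangle G (λ ()) (inj₁ vw) (inj₁ vz) (inj₁ wz) ,
    triangle G (λ ()) (inj₁ (adj-sym G vw)) (inj₁ wz) (inj₁ vz)
  ... | no ¬wz with orient G (z≢w ∘ ≡.sym) ¬wz (v , adj-sym G vw , adj-sym G vz)
  ...   | p , short , wz = [ p ] , s≤s z≤n , short ∷ [] ,
    triangle G loopless (inj₁ vw) (inj₁ vz) (inj₂ wz) ,
    triangle G loopless (inj₁ (adj-sym G vw)) (inj₂ wz) (inj₁ vz)
    where
    loopless : Loopless [ p ]
    loopless = normal-loopless G (proj₁ short ∷ [])

  edge-closable : ∀ {v w} → Adj G v w → Closable v w
  edge-closable {v} {w} vw with any? (λ z → adj? G v z ×-dec ¬? (z ≟ w))
  ... | yes (z , vz , z≢w) = closable-via vw vz z≢w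
  ... | no ∄v with any? (λ z → adj? G w z ×-dec ¬? (z ≟ v))
  ...   | yes (z , wz , z≢v) = closable-sym (closable-via (adj-sym G vw) wz z≢v)
  ...   | no ∄w = ⊥-elim (no-isolated-edge (sole-neighbour G ∄v) (sole-neighbour G ∄w))

  triangulate : ∀ J → All (uncurry (Adj G)) J →
    ∃[ R ] (length R ≤ length J × All (Short G) R × (∀ {y} → Any (Covers y) J → InTriangle G R y))
  triangulate []            []          = [] , z≤n , [] , λ ()
  triangulate ((v , w) ∷ J) (vw ∷ adjJ) with edge-closable vw | triangulate J adjJ
  ... | L , |L|≤1 , shortL , in-v , in-w | R , |R|≤|J| , shortR , inR =
    L ++ R , ≤-trans (≤-reflexive (length-++ L)) (+-mono-≤ |L|≤1 |R|≤|J|) ,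
    AllP.++⁺ shortL shortR , in-L++R
    where
    in-L++R : ∀ {y} → Any (Covers y) ((v , w) ∷ J) → InTriangle G (L ++ R) y
    in-L++R (here (inj₁ refl)) = inTriangle-mono G ∈-++⁺ˡ in-v
    in-L++R (here (inj₂ refl)) = inTriangle-mono G ∈-++⁺ˡ in-w
    in-L++R (there y∈J)        = inTriangle-mono G (∈-++⁺ʳ L) (inR y∈J)

  cover⇒triangles : ∀ {k U} → Cover G k U →
    ∃[ R ] (length R ≤ k × All (Short G) R × (∀ {y} → U y → InTriangle G R y))
  cover⇒triangles c with triangulate (Cover.edges c) (Cover.adjacent c)
  ... | R , |R|≤ , shortR , inR = R , ≤-trans |R|≤ (Cover.small c) , shortR , inR ∘ Cover.covers c

module _ {n : ℕ} (G : Graph n) (X : Subset n) where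

  Covering : List (Edge n) → Set
  Covering E = ∀ x → x ∈ₛ X → InTriangle G E x

  module Split {F : List (Edge n)} (normal : ∀ {u v} → (u , v) ∈ F → Normal G (u , v)) where

    goodPart : List (Edge n)
    goodPart = filter (good? G) F

    badPart : List (Edge n)
    badPart = filter (∁? (good? G)) F

    goodPart-short : All (Short G) goodPart
    goodPart-short = All.tabulate short
      where
      short : ∀ {p} → p ∈ goodPart → Short G p
      short {u , v} uv∈ with ∈-filter⁻ (good? G) {xs = F} uv∈
      ... | uv∈F , good = normal uv∈F , good

    goodPart-loopless : Loopless goodPart
    goodPart-loopless = normal-loopless G (All.map proj₁ goodPart-short)

    joined-good : ∀ {u v} → Joined F u v → CommonNeighbour G u v → Joined goodPart u v
    joined-good (inj₁ uv∈F) cn = inj₁ (∈-filter⁺ (good? G) uv∈F cn)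
    joined-good (inj₂ vu∈F) cn = inj₂ (∈-filter⁺ (good? G) vu∈F (commonNeighbour-sym G cn))

    joined-bad : ∀ {u v} → Joined F u v → ¬ CommonNeighbour G u v → Joined badPart u v
    joined-bad (inj₁ uv∈F) ¬cn = inj₁ (∈-filter⁺ (∁? (good? G)) uv∈F ¬cn)
    joined-bad (inj₂ vu∈F) ¬cn = inj₂ (∈-filter⁺ (∁? (good? G)) vu∈F (¬cn ∘ commonNeighbour-sym G))

    good-in-triangle : ∀ {u v} → Joined F u v → CommonNeighbour G u v → InTriangle G goodPart u
    good-in-triangle uv (w , uw , vw) =
      triangle G goodPart-loopless (inj₂ (joined-good uv (w , uw , vw))) (inj₁ uw) (inj₁ vw)

    bad-at : ∀ {y a} → ¬ InTriangle G goodPart y → Joined F y a → Joined badPart y a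
    bad-at {y} {a} ¬tri ya with commonNeighbour? G y a
    ... | yes cn  = ⊥-elim (¬tri (good-in-triangle ya cn))
    ... | no  ¬cn = joined-bad ya ¬cn

    Uncovered : Pred (Fin n) 0ℓ
    Uncovered y = y ∈ₛ X × ¬ InTriangle G goodPart y

    uncovered? : Decidable Uncovered
    uncovered? y = (y ∈ₛ? X) ×-dec ¬? (inTriangle? G goodPart y)

    hook-support : ∀ {y a b} → ¬ InTriangle G goodPart y → Joined F y a → Adj G y b → AdjPlus G F a b →
      Supported G badPart Uncovered y
    hook-support ¬tri ya yb (inj₁ ab) = ⊥-elim (¬tri (good-in-triangle ya (_ , yb , ab)))
    hook-support {a = a} {b} ¬tri ya yb (inj₂ ab) with commonNeighbour? G a b
    ... | yes cn  = leave (bad-at ¬tri ya) (λ (_ , ¬tri-a) → ¬tri-a (good-in-triangle ab cn))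
    ... | no  ¬cn = hook (bad-at ¬tri ya) yb (joined-bad ab ¬cn)

    bad-support : ∀ {y} → ¬ InTriangle G goodPart y → InTriangle G F y → Supported G badPart Uncovered y
    bad-support {y} ¬tri (a , b , _ , _ , a≢b , ya , yb , ab) = support ya yb ab
      where
      support : AdjPlus G F y a → AdjPlus G F y b → AdjPlus G F a b → Supported G badPart Uncovered y
      support (inj₁ ya) (inj₁ yb) (inj₁ ab) =
        ⊥-elim (¬tri (triangle G goodPart-loopless (inj₁ ya) (inj₁ yb) (inj₁ ab)))
      support (inj₁ ya) (inj₁ yb) (inj₂ ab) =
        ⊥-elim (¬tri (triangle G goodPart-loopless (inj₁ ya) (inj₁ yb)
                       (inj₂ (joined-good ab (y , adj-sym G ya , adj-sym G yb)))))
      support (inj₂ ya) (inj₂ yb) _  = fork a≢b (bad-at ¬tri ya) (bad-at ¬tri yb)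
      support (inj₂ ya) (inj₁ yb) ab = hook-support ¬tri ya yb ab
      support (inj₁ ya) (inj₂ yb) ab = hook-support ¬tri yb ya (adjPlus-sym G ab)

    bad-cover : ComponentsAtLeast3 G → Covering F → Cover G (length badPart) Uncovered
    bad-cover G≥3 inTriangles = Forest.supported-cover (neighbour G≥3) badPart uncovered?
      (λ (y∈X , ¬tri) → bad-support ¬tri (inTriangles _ y∈X))

  Candidate : List (Edge n) → Set
  Candidate S = Unique S × All (Short G) S × Covering S

  candidate? : Decidable Candidate
  candidate? S = unique? _≟ₑ_ S ×-dec All.all? (λ p → normal? G p ×-dec good? G p) S ×-dec
                 all? (λ x → (x ∈ₛ? X) →-dec inTriangle? G S x)

  candidates : List (List (Edge n))
  candidates = filter candidate? (sublists allPairs)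

  canonical : ∀ {E} → All (Short G) E → Covering E → ∃[ S ] (S ∈ candidates × length S ≤ length E)
  canonical {E} shortE coveringE =
    S , ∈-filter⁺ candidate? (filter∈sublists (_∈ₑ? E) allPairs) (uniqueS , shortS , coveringS) ,
    Unique-⊆⇒length≤ _≟ₑ_ uniqueS S⊆E
    where
    -- Read off along allPairs, E loses its duplicates and becomes one of the finitely many candidates.
    S : List (Edge n)
    S = filter (_∈ₑ? E) allPairs
    S⊆E : S ⊆ E
    S⊆E = proj₂ ∘ ∈-filter⁻ (_∈ₑ? E) {xs = allPairs}
    E⊆S : E ⊆ S
    E⊆S {u , v} = ∈-filter⁺ (_∈ₑ? E) (∈-cartesianProduct⁺ (∈-allFin u) (∈-allFin v))
    uniqueS : Unique S
    uniqueS = filter⁺ (_∈ₑ? E) (cartesianProduct⁺ (allFin⁺ n) (allFin⁺ n))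
    shortS : All (Short G) S
    shortS = All.tabulate (All.lookup shortE ∘ S⊆E)
    coveringS : Covering S
    coveringS x x∈X = inTriangle-mono G E⊆S (coveringE x x∈X)

module _ {n : ℕ} {G : Graph n} (G≥3 : ComponentsAtLeast3 G) (X : Subset n) where

  exchange : ∀ {F} → IsCompletion G X F →
    ∃[ E ] (All (Short G) E × Covering G X E × length E ≤ length F)
  exchange {F} ((_ , normal) , inTriangles)
    with cover⇒triangles G≥3 (Split.bad-cover G X normal G≥3 inTriangles)
  ... | R , |R|≤ , shortR , inR = goodPart ++ R , AllP.++⁺ goodPart-short shortR , covering , size
    where
    open Split G X normal
    covering : Covering G X (goodPart ++ R)
    covering x x∈X with inTriangle? G goodPart x
    ... | yes tri = inTriangle-mono G ∈-++⁺ˡ tri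
    ... | no ¬tri = inTriangle-mono G (∈-++⁺ʳ goodPart) (inR (x∈X , ¬tri))
    size : length (goodPart ++ R) ≤ length F
    size = begin
      length (goodPart ++ R)          ≡⟨ length-++ goodPart ⟩
      length goodPart + length R      ≤⟨ +-monoʳ-≤ (length goodPart) |R|≤ ⟩
      length goodPart + length badPart ≡⟨ length-filter+filter-∁ (good? G) F ⟩
      length F                         ∎
      where open ≤-Reasoning

  some-candidate : ∃[ S ] (S ∈ candidates G X)
  some-candidate with cover⇒triangles G≥3 (Forest.cover-by-singles (neighbour G≥3) (allFin n))
  ... | R , _ , shortR , inR with canonical G X shortR (λ x _ → inR (∈-allFin x))
  ...   | S , S∈ , _ = S , S∈

corollary4p2 : (n : ℕ) (G : Graph n) → ComponentsAtLeast3 G → (X : Subset n) →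
    ∃[ F ] (IsMinCompletion G X F ×
    (∀ {u v : Fin n} → (u , v) ∈ F → CommonNeighbour G u v))
corollary4p2 n G G≥3 X with shortest (proj₂ (some-candidate G≥3 X))
... | F , F∈ , F-shortest with ∈-filter⁻ (candidate? G X) {xs = sublists allPairs} F∈
...   | _ , (unique , short , covering) =
  F , (((unique , proj₁ ∘ All.lookup short) , covering) , minimum) , proj₂ ∘ All.lookup short
  where
  minimum : ∀ F′ → IsCompletion G X F′ → length F ≤ length F′
  minimum F′ completion with exchange G≥3 X completion
  ... | E , shortE , coveringE , |E|≤|F′| with canonical G X shortE coveringE
  ...   | S , S∈ , |S|≤|E| = ≤-trans (F-shortest S∈) (≤-trans |S|≤|E| |E|≤|F′|)
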